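{- Let $G$ be a $\chi$-unavoidable connected ordered graph with at least one edge in which each vertex has at most one neighbor to its left (respectively, to its right). Then $G$ is a right caterpillar (respectively, a left caterpillar).
   Context: An ordered graph is a finite simple graph together with a linear order of its vertex set. A copy of an ordered graph $H$ in $F$ is a subgraph of $F$ (with inherited order) isomorphic to $H$ via an order-preserving bijection. An ordered graph $H$ is $\chi$-unavoidable if there is an integer $k$ such that every ordered graph of chromatic number at least $k$ contains a copy of $H$. A right star is an ordered star with all leaves to the right of its center; $\vec S_p$ is the right star with $p$ edges. The concatenation $G\circ G'$ is obtained from the vertex-disjoint union with all vertices of $G$ before all vertices of $G'$ by identifying the rightmost vertex of $G$ with the leftmost vertex of $G'$. A right caterpillar is an ordered graph of the form $\vec S_{d_i}\circ\cdots\circ\vec S_{d_1}$ for some $i\ge1$ and positive integers $d_1,\ldots,d_i$. A left caterpillar is the mirror image (vertex order reversed) of a right caterpillar. -}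

module Defs where

open import Data.Nat using (ℕ; zero; suc; _+_; _∸_; _<_; _≤ᵇ_; _≡ᵇ_)
open import Data.Bool using (Bool; true; false; _∧_; _∨_; T)
open import Data.Fin using (Fin; toℕ)
open import Data.List using (List; []; _∷_)
open import Data.List.Relation.Unary.All using (All)
open import Data.Product using (Σ; _×_; ∃)
open import Relation.Binary.PropositionalEquality using (_≡_; _≢_)
open import Relation.Nullary using (¬_)
open import Function.Bundles using (_⇔_)

-- Ordered graphs.  The vertex set is {0,…,size-1} (i.e. Fin size) with
-- its natural linear order.  Adjacency is given by a Boolean function on
-- ℕ; only arguments < size matter.

record OGraph : Set where
  constructor mkOGraph
  field
    size : ℕ
    adj  : ℕ → ℕ → Bool

open OGraph public

Vertex : OGraph → Set
Vertex G = Fin (size G)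

Adj : (G : OGraph) → Vertex G → Vertex G → Set
Adj G u v = T (adj G (toℕ u) (toℕ v))

IsSimple : OGraph → Set
IsSimple G = (∀ (u v : Vertex G) → adj G (toℕ u) (toℕ v) ≡ adj G (toℕ v) (toℕ u))
           × (∀ (u : Vertex G) → adj G (toℕ u) (toℕ u) ≡ false)

Colorable : OGraph → ℕ → Set
Colorable F k = Σ (Vertex F → Fin k) λ c → ∀ u v → Adj F u v → c u ≢ c v

ChromaticAtLeast : OGraph → ℕ → Set
ChromaticAtLeast F k = ∀ m → m < k → ¬ Colorable F m

StrictlyMonotone : {m n : ℕ} → (Fin m → Fin n) → Set
StrictlyMonotone {m} f = ∀ (u v : Fin m) → toℕ u < toℕ v → toℕ (f u) < toℕ (f v)

ContainsCopy : (F H : OGraph) → Set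
ContainsCopy F H = Σ (Vertex H → Vertex F) λ f →
  StrictlyMonotone f × (∀ u v → Adj H u v → Adj F (f u) (f v))

OrdIso : (H G : OGraph) → Set
OrdIso H G = Σ (Vertex H → Vertex G) λ f →
  StrictlyMonotone f × (∀ (w : Vertex G) → ∃ λ u → f u ≡ w)
  × (∀ u v → Adj H u v ⇔ Adj G (f u) (f v))

ChiUnavoidable : OGraph → Set
ChiUnavoidable H = Σ ℕ λ k → ∀ (F : OGraph) → IsSimple F →
  ChromaticAtLeast F k → ContainsCopy F H

data Reach (G : OGraph) : Vertex G → Vertex G → Set where
  here : ∀ {u} → Reach G u u
  step : ∀ {u v w} → Adj G u v → Reach G v w → Reach G u w

Connected : OGraph → Set
Connected G = ∀ u v → Reach G u v

HasEdge : OGraph → Set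
HasEdge G = Σ (Vertex G) λ u → Σ (Vertex G) λ v → Adj G u v

AtMostOneLeftNeighbour : OGraph → Set
AtMostOneLeftNeighbour G = ∀ (v u w : Vertex G) →
  toℕ u < toℕ v → toℕ w < toℕ v → Adj G u v → Adj G w v → u ≡ w

AtMostOneRightNeighbour : OGraph → Set
AtMostOneRightNeighbour G = ∀ (v u w : Vertex G) →
  toℕ v < toℕ u → toℕ v < toℕ w → Adj G v u → Adj G v w → u ≡ w

rightStar : ℕ → OGraph
rightStar p = mkOGraph (suc p) λ x y →
  ((x ≡ᵇ 0) ∧ (1 ≤ᵇ y) ∧ (y ≤ᵇ p)) ∨ ((y ≡ᵇ 0) ∧ (1 ≤ᵇ x) ∧ (x ≤ᵇ p))

-- concatenation G ∘ G' (intended for nonempty G, G'): vertices of G are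
-- 0,…,a where a = size G - 1, vertices of G' are shifted by a, so the
-- rightmost vertex of G is identified with the leftmost vertex of G'.
concatOG : OGraph → OGraph → OGraph
concatOG G G' = mkOGraph (a + size G') λ x y →
  ((x ≤ᵇ a) ∧ (y ≤ᵇ a) ∧ adj G x y) ∨ ((a ≤ᵇ x) ∧ (a ≤ᵇ y) ∧ adj G' (x ∸ a) (y ∸ a))
  where a = size G ∸ 1

-- caterpillar d (e₁ ∷ … ∷ eⱼ) = S_d ∘ S_{e₁} ∘ ⋯ ∘ S_{eⱼ}
-- (so S_{d_i} ∘ ⋯ ∘ S_{d_1} is caterpillar d_i (d_{i-1} ∷ … ∷ d_1 ∷ []))
caterpillar : ℕ → List ℕ → OGraph
caterpillar d []       = rightStar d
caterpillar d (e ∷ es) = concatOG (rightStar d) (caterpillar e es)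

IsRightCaterpillar : OGraph → Set
IsRightCaterpillar G = Σ ℕ λ d → Σ (List ℕ) λ ds →
  (0 < d) × All (0 <_) ds × OrdIso (caterpillar d ds) G

mirror : OGraph → OGraph
mirror G = mkOGraph (size G) λ x y → adj G (size G ∸ 1 ∸ x) (size G ∸ 1 ∸ y)

IsLeftCaterpillar : OGraph → Set
IsLeftCaterpillar G = Σ ℕ λ d → Σ (List ℕ) λ ds →
  (0 < d) × All (0 <_) ds × OrdIso (mirror (caterpillar d ds)) G

module Submission where

-- A χ-unavoidable graph avoids every ordered pattern that is avoided by graphs of
-- arbitrarily large chromatic number.  Two patterns on a < b < c < e qualify: the
-- crossing pattern ab, ac, be is avoided by Zykov's graphs, whose selector vertices
-- have one neighbour in each of the consecutive copies, and the nesting pattern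
-- ab, ae, bc is avoided by shift graphs.
--
-- Now let G be connected with at most one left neighbour per vertex, so that every
-- vertex but the first has exactly one.  If d is the last neighbour of vertex 0, then
-- avoiding the nesting pattern makes 0, …, d a right star centred at 0, and avoiding
-- the crossing pattern leaves no edge from below d to beyond d.  Hence G is this star
-- concatenated with a graph of the same kind on d, d + 1, …, and induction applies.
-- The left case is the mirror image, with the mirrored patterns.

open import Data.Nat
  using (ℕ; zero; suc; _+_; _*_; _∸_; _^_; _≤_; _<_; z≤n; s≤s; z<s; _≤ᵇ_; _≡ᵇ_; _≤?_; _<?_; _≟_; >-nonZero)
open import Data.Nat.Properties
open import Data.Nat.Induction using (<-rec)
open import Data.Bool using (Bool; true; false; _∧_; _∨_; T)
open import Data.Bool.Properties using (T-≡; T-∧; T-∨; ∧-comm; ∧-assoc; ∨-comm; ∧-zeroʳ; ∨-identityʳ)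
open import Data.Fin
  using (Fin; toℕ; fromℕ<; opposite; cast; splitAt; join; _↑ˡ_; _↑ʳ_; quotient; remainder; combine;
         finToFun; funToFin; punchOut)
open import Data.Fin.Patterns using (0F; 1F; 2F; 3F)
import Data.Fin.Properties as Fin
open import Data.Product using (Σ; ∃; _×_; _,_; proj₁; proj₂; uncurry)
open import Data.Sum using (_⊎_; inj₁; inj₂; [_,_])
import Data.Product as Prod
open import Data.Empty using (⊥; ⊥-elim)
open import Data.Unit using (tt)
open import Data.List using (List; []; _∷_)
import Data.List as List
open import Data.List.Relation.Unary.All using (All; []; _∷_)
import Data.List.Relation.Unary.All as All
open import Data.List.Relation.Unary.All.Properties using (map⁻)
open import Function using (_∘_; id)
open import Function.Bundles using (_⇔_; mk⇔; Equivalence)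
open import Relation.Binary.PropositionalEquality hiding ([_])
open import Relation.Nullary using (¬_; Dec; yes; no)
open import Relation.Nullary.Decidable using (T?; _×-dec_; ⌊_⌋; toWitness; fromWitness)
open import Relation.Binary.Definitions using (tri<; tri≈; tri>)
open import Defs

Pattern : Set
Pattern = List (Fin 4 × Fin 4)

crossing nesting : Pattern
crossing = (0F , 1F) ∷ (0F , 2F) ∷ (1F , 3F) ∷ []
nesting  = (0F , 1F) ∷ (0F , 3F) ∷ (1F , 2F) ∷ []

mirrorPattern : Pattern → Pattern
mirrorPattern = List.map (Prod.map opposite opposite)

OccursAt : {V : Set} → (V → V → Set) → (Fin 4 → V) → Pattern → Set
OccursAt E v = All (uncurry λ i j → E (v i) (v j))

Chain : (Fin 4 → ℕ) → Set
Chain r = r 0F < r 1F × r 1F < r 2F × r 2F < r 3F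

Avoids : {n : ℕ} → (Fin n → Fin n → Set) → Pattern → Set
Avoids E p = ∀ v → Chain (toℕ ∘ v) → ¬ OccursAt E v p

avoids-pullback : ∀ {m n} {E : Fin n → Fin n → Set} {E′ : Fin m → Fin m → Set}
                  (f : Fin m → Fin n) → StrictlyMonotone f → (∀ u v → E′ u v → E (f u) (f v)) →
                  ∀ p → Avoids E p → Avoids E′ p
avoids-pullback f mono hom p avoid v (lt₀ , lt₁ , lt₂) occ =
  avoid (f ∘ v) (mono _ _ lt₀ , mono _ _ lt₁ , mono _ _ lt₂)
        (All.map (λ { {i , j} → hom (v i) (v j) }) occ)

opposite-< : ∀ {n} {u v : Fin n} → toℕ u < toℕ v → toℕ (opposite v) < toℕ (opposite u)
opposite-< {n} {u} {v} u<v rewrite Fin.opposite-prop u | Fin.opposite-prop v =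
  ∸-monoʳ-< (s≤s u<v) (Fin.toℕ<n v)

avoids-mirror : ∀ {n} {E : Fin n → Fin n → Set} p →
                Avoids E p → Avoids (λ u v → E (opposite u) (opposite v)) (mirrorPattern p)
avoids-mirror p avoid v (lt₀ , lt₁ , lt₂) occ =
  avoid (opposite ∘ v ∘ opposite) (opposite-< lt₂ , opposite-< lt₁ , opposite-< lt₀) (map⁻ occ)

quadruple : {A : Set} → A → A → A → A → Fin 4 → A
quadruple a b c e 0F = a
quadruple a b c e 1F = b
quadruple a b c e 2F = c
quadruple a b c e 3F = e

module Below (G : OGraph) where

  vertex : ∀ {x} → x < size G → Vertex G
  vertex x<n = fromℕ< x<n

  toℕ-vertex : ∀ {x} (x<n : x < size G) → toℕ (vertex x<n) ≡ x
  toℕ-vertex x<n = Fin.toℕ-fromℕ< x<n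

  vertex-< : ∀ {x y} (x<n : x < size G) (y<n : y < size G) → x < y → toℕ (vertex x<n) < toℕ (vertex y<n)
  vertex-< x<n y<n = subst₂ _<_ (sym (toℕ-vertex x<n)) (sym (toℕ-vertex y<n))

  Adj-vertex : ∀ {x y} (x<n : x < size G) (y<n : y < size G) →
               T (adj G x y) → Adj G (vertex x<n) (vertex y<n)
  Adj-vertex x<n y<n = subst₂ (λ x y → T (adj G x y)) (sym (toℕ-vertex x<n)) (sym (toℕ-vertex y<n))

  adj-symmetric : IsSimple G → ∀ {x y} → x < size G → y < size G → adj G x y ≡ adj G y x
  adj-symmetric (sym-adj , _) x<n y<n =
    subst₂ (λ x y → adj G x y ≡ adj G y x) (toℕ-vertex x<n) (toℕ-vertex y<n)
           (sym-adj (vertex x<n) (vertex y<n))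

  adj-irreflexive : IsSimple G → ∀ {x} → x < size G → adj G x x ≡ false
  adj-irreflexive (_ , irrefl) x<n = subst (λ x → adj G x x ≡ false) (toℕ-vertex x<n) (irrefl (vertex x<n))

AvoidsBelow : ℕ → (ℕ → ℕ → Bool) → Pattern → Set
AvoidsBelow n A p = ∀ v → Chain v → v 3F < n → ¬ OccursAt (λ x y → T (A x y)) v p

avoidsBelow-shift : ∀ {n A} d p → d ≤ n → AvoidsBelow n A p →
                    AvoidsBelow (n ∸ d) (λ x y → A (x + d) (y + d)) p
avoidsBelow-shift d p d≤n avoid v (lt₀ , lt₁ , lt₂) v₃<n∸d =
  avoid ((_+ d) ∘ v) (+-monoˡ-< d lt₀ , +-monoˡ-< d lt₁ , +-monoˡ-< d lt₂)
        (subst (v 3F + d <_) (m∸n+n≡m d≤n) (+-monoˡ-< d v₃<n∸d))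

avoids⇒avoidsBelow : ∀ G p → Avoids (Adj G) p → AvoidsBelow (size G) (adj G) p
avoids⇒avoidsBelow G p avoid v (lt₀ , lt₁ , lt₂) v₃<n occ =
  avoid (λ i → vertex (bound i))
        ( vertex-< (bound 0F) (bound 1F) lt₀
        , vertex-< (bound 1F) (bound 2F) lt₁
        , vertex-< (bound 2F) (bound 3F) lt₂)
        (All.map (λ { {i , j} → Adj-vertex (bound i) (bound j) }) occ)
  where
  open Below G
  bound : ∀ i → v i < size G
  bound 0F = <-trans lt₀ (<-trans lt₁ (<-trans lt₂ v₃<n))
  bound 1F = <-trans lt₁ (<-trans lt₂ v₃<n)
  bound 2F = <-trans lt₂ v₃<n
  bound 3F = v₃<n

ChiAvoidable : Pattern → Set
ChiAvoidable p = ∀ k → Σ OGraph λ F → IsSimple F × ChromaticAtLeast F k × Avoids (Adj F) p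

chiUnavoidable-avoids : ∀ {G} p → ChiUnavoidable G → ChiAvoidable p → Avoids (Adj G) p
chiUnavoidable-avoids p (k , unavoidable) avoidable
  with avoidable k
... | F , simple , χ≥k , avoid with unavoidable F simple χ≥k
...   | f , mono , hom = avoids-pullback {E = Adj F} f mono hom p avoid

reflect : ℕ → ℕ → ℕ
reflect n x = n ∸ 1 ∸ x

reflect-< : ∀ {n x} → x < n → reflect n x < n
reflect-< {suc n} {x} _ = s≤s (m∸n≤m n x)

reflect-involutive : ∀ {n x} → x < n → reflect n (reflect n x) ≡ x
reflect-involutive {suc n} x<n = m∸[m∸n]≡n (≤-pred x<n)

toℕ-opposite : ∀ {n} (u : Fin n) → toℕ (opposite u) ≡ reflect n (toℕ u)
toℕ-opposite {n} u = trans (Fin.opposite-prop u) (sym (∸-+-assoc n 1 (toℕ u)))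

module _ (G : OGraph) where

  adj-mirror : ∀ (u v : Vertex G) →
               adj (mirror G) (toℕ u) (toℕ v) ≡ adj G (toℕ (opposite u)) (toℕ (opposite v))
  adj-mirror u v = sym (cong₂ (adj G) (toℕ-opposite u) (toℕ-opposite v))

  Adj-mirror-opposite : ∀ {u v} → Adj G u v → Adj (mirror G) (opposite u) (opposite v)
  Adj-mirror-opposite {u} {v} uv = subst T (sym (adj-mirror (opposite u) (opposite v)))
    (subst₂ (Adj G) (sym (Fin.opposite-involutive u)) (sym (Fin.opposite-involutive v)) uv)

  mirror-simple : IsSimple G → IsSimple (mirror G)
  mirror-simple (sym-adj , irrefl) =
      (λ u v → trans (adj-mirror u v) (trans (sym-adj (opposite u) (opposite v)) (sym (adj-mirror v u))))
    , (λ u → trans (adj-mirror u u) (irrefl (opposite u)))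

  mirror-chromatic : ∀ {k} → ChromaticAtLeast G k → ChromaticAtLeast (mirror G) k
  mirror-chromatic χ≥k m m<k (c , proper) =
    χ≥k m m<k (c ∘ opposite , λ u v uv → proper (opposite u) (opposite v) (Adj-mirror-opposite uv))

  mirror-avoids : ∀ p → Avoids (Adj G) p → Avoids (Adj (mirror G)) (mirrorPattern p)
  mirror-avoids p avoid =
    avoids-pullback {E = λ u v → Adj G (opposite u) (opposite v)} id (λ _ _ u<v → u<v)
                    (λ u v → subst T (adj-mirror u v)) _ (avoids-mirror {E = Adj G} p avoid)

  mirror-connected : Connected G → Connected (mirror G)
  mirror-connected connected u v =
    subst₂ (Reach (mirror G)) (Fin.opposite-involutive u) (Fin.opposite-involutive v)
           (mirror-reach (connected (opposite u) (opposite v)))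
    where
    mirror-reach : ∀ {u v} → Reach G u v → Reach (mirror G) (opposite u) (opposite v)
    mirror-reach here = here
    mirror-reach (step uv r) = step (Adj-mirror-opposite uv) (mirror-reach r)

  mirror-hasEdge : HasEdge G → HasEdge (mirror G)
  mirror-hasEdge (u , v , uv) = opposite u , opposite v , Adj-mirror-opposite uv

  mirror-atMostOneLeftNeighbour : IsSimple G → AtMostOneRightNeighbour G → AtMostOneLeftNeighbour (mirror G)
  mirror-atMostOneLeftNeighbour (sym-adj , _) unique v u w u<v w<v uv wv =
    trans (sym (Fin.opposite-involutive u))
          (trans (cong opposite (unique (opposite v) (opposite u) (opposite w)
                                        (opposite-< u<v) (opposite-< w<v) (flip u uv) (flip w wv)))
                 (Fin.opposite-involutive w))
    where
    flip : ∀ x → Adj (mirror G) x v → Adj G (opposite v) (opposite x)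
    flip x xv = subst T (sym-adj (opposite x) (opposite v)) (subst T (adj-mirror x v) xv)

chiAvoidable-mirror : ∀ p → ChiAvoidable p → ChiAvoidable (mirrorPattern p)
chiAvoidable-mirror p avoidable k with avoidable k
... | F , simple , χ≥k , avoid =
  mirror F , mirror-simple F simple , mirror-chromatic F χ≥k , mirror-avoids F p avoid

¬T⇒≡false : ∀ {b} → ¬ T b → b ≡ false
¬T⇒≡false {false} _ = refl
¬T⇒≡false {true} ¬t = ⊥-elim (¬t tt)

≤⇒≤ᵇ≡true : ∀ {m n} → m ≤ n → (m ≤ᵇ n) ≡ true
≤⇒≤ᵇ≡true m≤n = Equivalence.to T-≡ (≤⇒≤ᵇ m≤n)

>⇒≤ᵇ≡false : ∀ {m n} → n < m → (m ≤ᵇ n) ≡ false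
>⇒≤ᵇ≡false {m} {n} n<m = ¬T⇒≡false (<⇒≱ n<m ∘ ≤ᵇ⇒≤ m n)

rightStar-adj : ∀ d {x y} → x < y → y ≤ d → adj (rightStar d) x y ≡ (x ≡ᵇ 0)
rightStar-adj d {x} {suc y} _ y<d rewrite ≤⇒≤ᵇ≡true y<d | ∧-comm (x ≡ᵇ 0) true = ∨-identityʳ _

module _ (d : ℕ) (C : OGraph) {x y : ℕ} where

  private
    S = adj (rightStar d) x y
    R = adj C (x ∸ d) (y ∸ d)

  concat-adj-star : x < y → y ≤ d → adj (concatOG (rightStar d) C) x y ≡ (x ≡ᵇ 0)
  concat-adj-star x<y y≤d =
    trans (guards (x ≤ᵇ d) (y ≤ᵇ d) (d ≤ᵇ x) (d ≤ᵇ y)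
                  (≤⇒≤ᵇ≡true (<⇒≤ x<d)) (≤⇒≤ᵇ≡true y≤d) (>⇒≤ᵇ≡false x<d))
          (rightStar-adj d x<y y≤d)
    where
    x<d = <-≤-trans x<y y≤d
    guards : ∀ X Y Z W → X ≡ true → Y ≡ true → Z ≡ false → (X ∧ Y ∧ S) ∨ (Z ∧ W ∧ R) ≡ S
    guards _ _ _ _ refl refl refl = ∨-identityʳ S

  concat-adj-across : x < d → d < y → adj (concatOG (rightStar d) C) x y ≡ false
  concat-adj-across x<d d<y =
    guards (x ≤ᵇ d) (y ≤ᵇ d) (d ≤ᵇ x) (d ≤ᵇ y) (>⇒≤ᵇ≡false d<y) (>⇒≤ᵇ≡false x<d)
    where
    guards : ∀ X Y Z W → Y ≡ false → Z ≡ false → (X ∧ Y ∧ S) ∨ (Z ∧ W ∧ R) ≡ false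
    guards X _ _ _ refl refl = trans (∨-identityʳ _) (∧-zeroʳ X)

  concat-adj-right : d ≤ x → d < y → adj (concatOG (rightStar d) C) x y ≡ R
  concat-adj-right d≤x d<y =
    guards (x ≤ᵇ d) (y ≤ᵇ d) (d ≤ᵇ x) (d ≤ᵇ y)
           (>⇒≤ᵇ≡false d<y) (≤⇒≤ᵇ≡true d≤x) (≤⇒≤ᵇ≡true (<⇒≤ d<y))
    where
    guards : ∀ X Y Z W → Y ≡ false → Z ≡ true → W ≡ true → (X ∧ Y ∧ S) ∨ (Z ∧ W ∧ R) ≡ R
    guards X _ _ _ refl refl refl = cong (_∨ R) (∧-zeroʳ X)

caterpillar-adj-sym : ∀ d ds x y → adj (caterpillar d ds) x y ≡ adj (caterpillar d ds) y x
caterpillar-adj-sym d [] x y =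
  ∨-comm ((x ≡ᵇ 0) ∧ (1 ≤ᵇ y) ∧ (y ≤ᵇ d)) ((y ≡ᵇ 0) ∧ (1 ≤ᵇ x) ∧ (x ≤ᵇ d))
caterpillar-adj-sym d (e ∷ es) x y =
  cong₂ _∨_ (trans (cong ((x ≤ᵇ d) ∧_) (cong ((y ≤ᵇ d) ∧_) (caterpillar-adj-sym d [] x y)))
                   (swap (x ≤ᵇ d) (y ≤ᵇ d) _))
            (trans (cong ((d ≤ᵇ x) ∧_) (cong ((d ≤ᵇ y) ∧_) (caterpillar-adj-sym e es (x ∸ d) (y ∸ d))))
                   (swap (d ≤ᵇ x) (d ≤ᵇ y) _))
  where
  swap : ∀ a b c → a ∧ b ∧ c ≡ b ∧ a ∧ c
  swap a b c = trans (sym (∧-assoc a b c)) (trans (cong (_∧ c) (∧-comm a b)) (∧-assoc b a c))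

caterpillar-irreflexive : ∀ d ds x → adj (caterpillar d ds) x x ≡ false
caterpillar-irreflexive d [] x = rightStar-irreflexive x
  where
  rightStar-irreflexive : ∀ x → adj (rightStar d) x x ≡ false
  rightStar-irreflexive zero = refl
  rightStar-irreflexive (suc x) = refl
caterpillar-irreflexive d (e ∷ es) x
  rewrite caterpillar-irreflexive d [] x | caterpillar-irreflexive e es (x ∸ d)
        | ∧-zeroʳ (x ≤ᵇ d) | ∧-zeroʳ (d ≤ᵇ x)
  = cong₂ _∨_ (∧-zeroʳ (x ≤ᵇ d)) (∧-zeroʳ (d ≤ᵇ x))

-- Recognising right caterpillars

-- Adjacency is taken on ℕ, restricted to the first n vertices, so that removing the
-- first star is merely a shift of all indices by d.
record RightCaterpillarConditions (n : ℕ) (A : ℕ → ℕ → Bool) : Set where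
  field
    left-neighbour-unique : ∀ {u w v} → u < v → w < v → v < n → T (A u v) → T (A w v) → u ≡ w
    left-neighbour        : ∀ {v} → 0 < v → v < n → ∃ λ u → u < v × T (A u v)
    avoids-crossing       : AvoidsBelow n A crossing
    avoids-nesting        : AvoidsBelow n A nesting

  no-crossing : ∀ {a b c e} → a < b → b < c → c < e → e < n →
                T (A a b) → T (A a c) → T (A b e) → ⊥
  no-crossing {a} {b} {c} {e} ab bc ce e<n t₁ t₂ t₃ =
    avoids-crossing (quadruple a b c e) (ab , bc , ce) e<n (t₁ ∷ t₂ ∷ t₃ ∷ [])

  no-nesting : ∀ {a b c e} → a < b → b < c → c < e → e < n →
               T (A a b) → T (A a e) → T (A b c) → ⊥
  no-nesting {a} {b} {c} {e} ab bc ce e<n t₁ t₂ t₃ =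
    avoids-nesting (quadruple a b c e) (ab , bc , ce) e<n (t₁ ∷ t₂ ∷ t₃ ∷ [])

record RightCaterpillarShape (n : ℕ) (A : ℕ → ℕ → Bool) : Set where
  constructor shape
  field
    first  : ℕ
    rest   : List ℕ
    first-positive : 0 < first
    rest-positive  : All (0 <_) rest
    size-caterpillar : size (caterpillar first rest) ≡ n
    agrees : ∀ {x y} → x < y → y < n → adj (caterpillar first rest) x y ≡ A x y

greatest : (P : ℕ → Bool) (n : ℕ) → ∃ (λ y → y < n × T (P y)) →
           ∃ λ d → d < n × T (P d) × (∀ {y} → d < y → y < n → ¬ T (P y))
greatest P zero (_ , () , _)
greatest P (suc n) witness with P n in Pn
... | true = n , ≤-refl , subst T (sym Pn) tt , λ n<y y≤n → ⊥-elim (<⇒≱ n<y (≤-pred y≤n))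
... | false with witness
...   | y , y<1+n , Py with m≤n⇒m<n∨m≡n (≤-pred y<1+n)
...     | inj₂ refl = ⊥-elim (subst T Pn Py)
...     | inj₁ y<n with greatest P n (y , y<n , Py)
...       | d , d<n , Pd , above = d , m<n⇒m<1+n d<n , Pd , beyond
  where
  beyond : ∀ {z} → d < z → z < suc n → ¬ T (P z)
  beyond d<z z<1+n with m≤n⇒m<n∨m≡n (≤-pred z<1+n)
  ... | inj₁ z<n = above d<z z<n
  ... | inj₂ refl = subst T Pn

module FirstStar {n A} (H : RightCaterpillarConditions n A) (1<n : 1 < n) where
  open RightCaterpillarConditions H

  0~1 : T (A 0 1)
  0~1 with left-neighbour {1} z<s 1<n
  ... | zero , _ , t = t
  ... | suc _ , s≤s () , _

  private
    last-neighbour = greatest (A 0) n (1 , 1<n , 0~1)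

  d : ℕ
  d = proj₁ last-neighbour

  d<n : d < n
  d<n = proj₁ (proj₂ last-neighbour)

  0~d : T (A 0 d)
  0~d = proj₁ (proj₂ (proj₂ last-neighbour))

  beyond-d : ∀ {y} → d < y → y < n → ¬ T (A 0 y)
  beyond-d = proj₂ (proj₂ (proj₂ last-neighbour))

  0<d : 0 < d
  0<d = ≰⇒> λ d≤0 → beyond-d (s≤s d≤0) 1<n 0~1

  d≤n : d ≤ n
  d≤n = <⇒≤ d<n

  centre-adj : ∀ {y} → 0 < y → y ≤ d → T (A 0 y)
  centre-adj {y} = <-rec (λ y → 0 < y → y ≤ d → T (A 0 y)) go y
    where
    go : ∀ y → (∀ {x} → x < y → 0 < x → x ≤ d → T (A 0 x)) → 0 < y → y ≤ d → T (A 0 y)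
    go y ih 0<y y≤d with left-neighbour 0<y (≤-<-trans y≤d d<n)
    ... | zero , _ , t = t
    ... | suc u , u<y , t with m≤n⇒m<n∨m≡n y≤d
    ...   | inj₂ refl = ⊥-elim (0≢1+n (left-neighbour-unique 0<y u<y d<n 0~d t))
    ...   | inj₁ y<d =
      ⊥-elim (no-nesting z<s u<y y<d d<n (ih u<y z<s (≤-trans (<⇒≤ u<y) y≤d)) 0~d t)

  star-adj : ∀ {x y} → x < y → y ≤ d → A x y ≡ (x ≡ᵇ 0)
  star-adj {zero} 0<y y≤d = Equivalence.to T-≡ (centre-adj 0<y y≤d)
  star-adj {suc x} x<y y≤d = ¬T⇒≡false λ t →
    0≢1+n (sym (left-neighbour-unique x<y 0<y (≤-<-trans y≤d d<n) t (centre-adj 0<y y≤d)))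
    where
    0<y = <-trans z<s x<y

  no-edge-across : ∀ {x y} → x < d → d < y → y < n → ¬ T (A x y)
  no-edge-across {zero} _ d<y y<n = beyond-d d<y y<n
  no-edge-across {suc x} x<d d<y y<n t =
    no-crossing z<s x<d d<y y<n (centre-adj z<s (<⇒≤ x<d)) 0~d t

  A′ : ℕ → ℕ → Bool
  A′ x y = A (x + d) (y + d)

  shift-< : ∀ {u} → u < n ∸ d → u + d < n
  shift-< {u} u<n∸d = subst (u + d <_) (m∸n+n≡m d≤n) (+-monoˡ-< d u<n∸d)

  shifted : RightCaterpillarConditions (n ∸ d) A′
  shifted = record
    { left-neighbour-unique = λ u<v w<v v<n∸d t₁ t₂ → +-cancelʳ-≡ d _ _
        (left-neighbour-unique (+-monoˡ-< d u<v) (+-monoˡ-< d w<v) (shift-< v<n∸d) t₁ t₂)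
    ; left-neighbour        = shifted-left-neighbour
    ; avoids-crossing       = avoidsBelow-shift {A = A} d crossing d≤n avoids-crossing
    ; avoids-nesting        = avoidsBelow-shift {A = A} d nesting d≤n avoids-nesting
    }
    where
    shifted-left-neighbour : ∀ {v} → 0 < v → v < n ∸ d → ∃ λ u → u < v × T (A′ u v)
    shifted-left-neighbour {v} 0<v v<n∸d
      with left-neighbour (<-≤-trans 0<v (m≤m+n v d)) (shift-< v<n∸d)
    ... | x , x<v+d , t = x ∸ d , subst (x ∸ d <_) (m+n∸n≡m v d) (∸-monoˡ-< x<v+d d≤x)
                        , subst (λ z → T (A z (v + d))) (sym (m∸n+n≡m d≤x)) t
      where
      d≤x : d ≤ x
      d≤x = ≮⇒≥ λ x<d → no-edge-across x<d (m<n+m d 0<v) (shift-< v<n∸d) t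

  concat-agrees : ∀ C → (∀ {x y} → x < y → y < n ∸ d → adj C x y ≡ A′ x y) →
                  ∀ {x y} → x < y → y < n → adj (concatOG (rightStar d) C) x y ≡ A x y
  concat-agrees C agrees {x} {y} x<y y<n with y ≤? d
  ... | yes y≤d = trans (concat-adj-star d C x<y y≤d) (sym (star-adj x<y y≤d))
  ... | no y≰d with d ≤? x
  ...   | no d≰x = trans (concat-adj-across d C (≰⇒> d≰x) (≰⇒> y≰d))
                         (sym (¬T⇒≡false (no-edge-across (≰⇒> d≰x) (≰⇒> y≰d) y<n)))
  ...   | yes d≤x = begin
    adj (concatOG (rightStar d) C) x y  ≡⟨ concat-adj-right d C d≤x (≰⇒> y≰d) ⟩
    adj C (x ∸ d) (y ∸ d)               ≡⟨ agrees (∸-monoˡ-< x<y d≤x) (∸-monoˡ-< y<n d≤y) ⟩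
    A (x ∸ d + d) (y ∸ d + d)           ≡⟨ cong₂ A (m∸n+n≡m d≤x) (m∸n+n≡m d≤y) ⟩
    A x y                               ∎
    where
    open ≡-Reasoning
    d≤y = ≤-trans d≤x (<⇒≤ x<y)

  reduce : (RightCaterpillarConditions (n ∸ d) A′ → 1 < n ∸ d → RightCaterpillarShape (n ∸ d) A′) →
           RightCaterpillarShape n A
  reduce recurse with 1 <? n ∸ d
  ... | yes 1<n∸d with recurse shifted 1<n∸d
  ...   | shape e es 0<e 0<es size-≡ agrees =
    shape d (e ∷ es) 0<d (0<e ∷ 0<es) (trans (cong (d +_) size-≡) (m+[n∸m]≡n d≤n))
          (concat-agrees (caterpillar e es) agrees)
  reduce recurse | no 1≮n∸d = shape d [] 0<d [] size-star star-agrees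
    where
    size-star : suc d ≡ n
    size-star = begin
      suc d        ≡⟨ +-comm 1 d ⟩
      d + 1        ≡⟨ cong (d +_) (≤-antisym (≮⇒≥ 1≮n∸d) (m<n⇒0<n∸m d<n)) ⟨
      d + (n ∸ d)  ≡⟨ m+[n∸m]≡n d≤n ⟩
      n            ∎
      where open ≡-Reasoning
    star-agrees : ∀ {x y} → x < y → y < n → adj (rightStar d) x y ≡ A x y
    star-agrees x<y y<n = trans (rightStar-adj d x<y y≤d) (sym (star-adj x<y y≤d))
      where
      y≤d = ≤-pred (subst (_ <_) (sym size-star) y<n)

  n∸d<n : n ∸ d < n
  n∸d<n = ∸-monoʳ-< 0<d d≤n

rightCaterpillarShape : ∀ n {A} → RightCaterpillarConditions n A → 1 < n → RightCaterpillarShape n A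
rightCaterpillarShape = <-rec Motive λ n recurse H 1<n →
  FirstStar.reduce H 1<n (recurse (FirstStar.n∸d<n H 1<n))
  where
  Motive : ℕ → Set
  Motive n = ∀ {A} → RightCaterpillarConditions n A → 1 < n → RightCaterpillarShape n A

module _ (G : OGraph) (unique : AtMostOneLeftNeighbour G) where

  data Rightward (y : Vertex G) : Vertex G → Set where
    start : Rightward y y
    extend : ∀ {u v} → Rightward y u → toℕ u < toℕ v → Adj G u v → Rightward y v

  rightward-≥ : ∀ {y t} → Rightward y t → toℕ y ≤ toℕ t
  rightward-≥ start = ≤-refl
  rightward-≥ (extend r u<v _) = ≤-trans (rightward-≥ r) (<⇒≤ u<v)

  -- A rightward path from y can be retraced backwards as long as y itself has
  -- no left neighbour, because the left neighbour of every later vertex is unique.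
  rightward-closed : IsSimple G → ∀ {y} → (∀ x → toℕ x < toℕ y → ¬ Adj G x y) →
                     ∀ {u v} → Rightward y u → Adj G u v → Rightward y v
  rightward-closed (sym-adj , irrefl) {y} no-left {u} {v} r uv with <-cmp (toℕ u) (toℕ v)
  ... | tri< u<v _ _ = extend r u<v uv
  ... | tri≈ _ u≡v _ = ⊥-elim (subst T (irrefl u) (subst (Adj G u) (sym (Fin.toℕ-injective u≡v)) uv))
  ... | tri> _ _ v<u = back r (subst T (sym-adj u v) uv) v<u
    where
    back : ∀ {u v} → Rightward y u → Adj G v u → toℕ v < toℕ u → Rightward y v
    back start vy v<y = ⊥-elim (no-left _ v<y vy)
    back (extend {w} r w<u wu) vu v<u = subst (Rightward y) (unique _ w _ w<u v<u wu vu) r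

  left-neighbour-exists : IsSimple G → Connected G →
                          ∀ y → 0 < toℕ y → ∃ λ x → toℕ x < toℕ y × Adj G x y
  left-neighbour-exists simple connected y 0<y
    with Fin.any? (λ x → (toℕ x <? toℕ y) ×-dec T? (adj G (toℕ x) (toℕ y)))
  ... | yes found = found
  ... | no none =
    ⊥-elim (<⇒≱ 0<y (subst (toℕ y ≤_) (Fin.toℕ-fromℕ< 0<n) (rightward-≥ rightward-0)))
    where
    0<n : 0 < size G
    0<n = <-trans 0<y (Fin.toℕ<n y)
    reach-rightward : ∀ {u t} → Rightward y u → Reach G u t → Rightward y t
    reach-rightward r here = r
    reach-rightward r (step uv path) =
      reach-rightward (rightward-closed simple (λ x x<y xy → none (x , x<y , xy)) r uv) path
    rightward-0 : Rightward y (fromℕ< 0<n)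
    rightward-0 = reach-rightward start (connected y (fromℕ< 0<n))

  rightCaterpillarConditions : IsSimple G → Connected G →
                               Avoids (Adj G) crossing → Avoids (Adj G) nesting →
                               RightCaterpillarConditions (size G) (adj G)
  rightCaterpillarConditions simple connected no-crossing no-nesting = record
    { left-neighbour-unique = unique-below
    ; left-neighbour        = left-neighbour-below
    ; avoids-crossing       = avoids⇒avoidsBelow G crossing no-crossing
    ; avoids-nesting        = avoids⇒avoidsBelow G nesting no-nesting
    }
    where
    open Below G
    unique-below : ∀ {u w v} → u < v → w < v → v < size G → T (adj G u v) → T (adj G w v) → u ≡ w
    unique-below u<v w<v v<n uv wv = begin
      _                  ≡⟨ toℕ-vertex u<n ⟨
      toℕ (vertex u<n)   ≡⟨ cong toℕ (unique (vertex v<n) (vertex u<n) (vertex w<n)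
                              (vertex-< u<n v<n u<v) (vertex-< w<n v<n w<v)
                              (Adj-vertex u<n v<n uv) (Adj-vertex w<n v<n wv)) ⟩
      toℕ (vertex w<n)   ≡⟨ toℕ-vertex w<n ⟩
      _                  ∎
      where
      open ≡-Reasoning
      u<n = <-trans u<v v<n
      w<n = <-trans w<v v<n
    left-neighbour-below : ∀ {v} → 0 < v → v < size G → ∃ λ u → u < v × T (adj G u v)
    left-neighbour-below {v} 0<v v<n
      with left-neighbour-exists simple connected (vertex v<n) (subst (0 <_) (sym (toℕ-vertex v<n)) 0<v)
    ... | x , x<v , xv = toℕ x , subst (toℕ x <_) (toℕ-vertex v<n) x<v
                               , subst (λ z → T (adj G (toℕ x) z)) (toℕ-vertex v<n) xv

hasEdge⇒1<size : ∀ G → IsSimple G → HasEdge G → 1 < size G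
hasEdge⇒1<size G (_ , irrefl) (u , v , uv) with <-cmp (toℕ u) (toℕ v)
... | tri< u<v _ _ = ≤-<-trans (≤-<-trans z≤n u<v) (Fin.toℕ<n v)
... | tri≈ _ u≡v _ = ⊥-elim (subst T (irrefl u) (subst (Adj G u) (sym (Fin.toℕ-injective u≡v)) uv))
... | tri> _ _ v<u = ≤-<-trans (≤-<-trans z≤n v<u) (Fin.toℕ<n u)

Agree : ℕ → (ℕ → ℕ → Bool) → (ℕ → ℕ → Bool) → Set
Agree n A B = ∀ {x y} → x < n → y < n → A x y ≡ B x y

agree⇒ordIso : ∀ C G → size C ≡ size G → Agree (size G) (adj C) (adj G) → OrdIso C G
agree⇒ordIso C G size-≡ agree = f , mono , onto , preserves
  where
  f : Vertex C → Vertex G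
  f = cast size-≡
  toℕ-f : ∀ u → toℕ (f u) ≡ toℕ u
  toℕ-f = Fin.toℕ-cast size-≡
  mono : StrictlyMonotone f
  mono u v = subst₂ _<_ (sym (toℕ-f u)) (sym (toℕ-f v))
  onto : ∀ w → ∃ λ u → f u ≡ w
  onto w = cast (sym size-≡) w , Fin.toℕ-injective (trans (toℕ-f _) (Fin.toℕ-cast (sym size-≡) w))
  adj-f : ∀ u v → adj C (toℕ u) (toℕ v) ≡ adj G (toℕ (f u)) (toℕ (f v))
  adj-f u v = trans (agree (bound u) (bound v)) (sym (cong₂ (adj G) (toℕ-f u) (toℕ-f v)))
    where
    bound : ∀ u → toℕ u < size G
    bound u = subst (toℕ u <_) size-≡ (Fin.toℕ<n u)
  preserves : ∀ u v → Adj C u v ⇔ Adj G (f u) (f v)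
  preserves u v = mk⇔ (subst T (adj-f u v)) (subst T (sym (adj-f u v)))

agree-mirror : ∀ C G → size C ≡ size G → Agree (size G) (adj C) (adj (mirror G)) →
               Agree (size G) (adj (mirror C)) (adj G)
agree-mirror C G refl agree x<n y<n =
  trans (agree (reflect-< x<n) (reflect-< y<n)) (cong₂ (adj G) (reflect-involutive x<n) (reflect-involutive y<n))

module _ (G : OGraph) (simple : IsSimple G) (S : RightCaterpillarShape (size G) (adj G)) where
  open RightCaterpillarShape S
  open Below G

  shape-agrees : Agree (size G) (adj (caterpillar first rest)) (adj G)
  shape-agrees {x} {y} x<n y<n with <-cmp x y
  ... | tri< x<y _ _ = agrees x<y y<n
  ... | tri≈ _ refl _ = trans (caterpillar-irreflexive first rest x) (sym (adj-irreflexive simple x<n))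
  ... | tri> _ _ y<x = begin
    adj (caterpillar first rest) x y  ≡⟨ caterpillar-adj-sym first rest x y ⟩
    adj (caterpillar first rest) y x  ≡⟨ agrees y<x x<n ⟩
    adj G y x                         ≡⟨ adj-symmetric simple y<n x<n ⟩
    adj G x y                         ∎
    where open ≡-Reasoning

  shape⇒isRightCaterpillar : IsRightCaterpillar G
  shape⇒isRightCaterpillar = first , rest , first-positive , rest-positive ,
    agree⇒ordIso (caterpillar first rest) G size-caterpillar shape-agrees

mirror-shape⇒isLeftCaterpillar : ∀ G → IsSimple G → RightCaterpillarShape (size G) (adj (mirror G)) →
                                 IsLeftCaterpillar G
mirror-shape⇒isLeftCaterpillar G simple S = first , rest , first-positive , rest-positive ,
  agree⇒ordIso (mirror (caterpillar first rest)) G size-caterpillar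
    (agree-mirror (caterpillar first rest) G size-caterpillar (shape-agrees (mirror G) (mirror-simple G simple) S))
  where open RightCaterpillarShape S

-- Graphs of large chromatic number avoiding a pattern

module Blocks {m : ℕ} (n : ℕ) where

  block : Fin (m * n) → Fin m
  block = quotient n

  offset : Fin (m * n) → Fin n
  offset = remainder {m} n

  combine-block-offset : ∀ r → combine (block r) (offset r) ≡ r
  combine-block-offset = Fin.combine-remQuot {m} n

  block-combine : ∀ i j → block (combine i j) ≡ i
  block-combine i j = cong proj₁ (Fin.remQuot-combine {m} {n} i j)

  offset-combine : ∀ i j → offset (combine i j) ≡ j
  offset-combine i j = cong proj₂ (Fin.remQuot-combine {m} {n} i j)

  toℕ-block-offset : ∀ r → toℕ r ≡ n * toℕ (block r) + toℕ (offset r)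
  toℕ-block-offset r = trans (cong toℕ (sym (combine-block-offset r))) (Fin.toℕ-combine (block r) (offset r))

  block-< : ∀ {r r′} → toℕ (block r) < toℕ (block r′) → toℕ r < toℕ r′
  block-< {r} {r′} b<b′ =
    subst₂ (λ s s′ → toℕ s < toℕ s′) (combine-block-offset r) (combine-block-offset r′)
           (Fin.combine-monoˡ-< (offset r) (offset r′) b<b′)

  block-mono : ∀ {r r′} → toℕ r < toℕ r′ → toℕ (block r) ≤ toℕ (block r′)
  block-mono r<r′ = ≮⇒≥ λ b′<b → <-asym r<r′ (block-< b′<b)

  offset-< : ∀ {r r′} → block r ≡ block r′ → toℕ r < toℕ r′ → toℕ (offset r) < toℕ (offset r′)
  offset-< {r} {r′} b≡b′ r<r′ = +-cancelˡ-< (n * toℕ (block r)) _ _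
    (subst₂ _<_ (toℕ-block-offset r)
                (trans (toℕ-block-offset r′) (cong (λ b → n * toℕ b + toℕ (offset r′)) (sym b≡b′))) r<r′)

record FinGraph : Set where
  constructor finGraph
  field
    order : ℕ
    edge  : Fin order → Fin order → Bool

open FinGraph

Edge : (F : FinGraph) → Fin (order F) → Fin (order F) → Set
Edge F u v = T (edge F u v)

EdgeSymmetric EdgeIrreflexive : FinGraph → Set
EdgeSymmetric F = ∀ u v → edge F u v ≡ edge F v u
EdgeIrreflexive F = ∀ u → edge F u u ≡ false

Colouring : FinGraph → ℕ → Set
Colouring F k = Σ (Fin (order F) → Fin k) λ c → ∀ u v → Edge F u v → c u ≢ c v

FinChromaticAtLeast : FinGraph → ℕ → Set
FinChromaticAtLeast F k = ∀ m → m < k → ¬ Colouring F m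

edgeℕ : (F : FinGraph) → ℕ → ℕ → Bool
edgeℕ F x y with x <? order F | y <? order F
... | yes x<n | yes y<n = edge F (fromℕ< x<n) (fromℕ< y<n)
... | _       | _       = false

toOGraph : FinGraph → OGraph
toOGraph F = mkOGraph (order F) (edgeℕ F)

edgeℕ-toℕ : ∀ F u v → edgeℕ F (toℕ u) (toℕ v) ≡ edge F u v
edgeℕ-toℕ F u v with toℕ u <? order F | toℕ v <? order F
... | yes u<n | yes v<n = cong₂ (edge F) (Fin.fromℕ<-toℕ u u<n) (Fin.fromℕ<-toℕ v v<n)
... | no u≮n  | _       = ⊥-elim (u≮n (Fin.toℕ<n u))
... | yes _   | no v≮n  = ⊥-elim (v≮n (Fin.toℕ<n v))

finGraph-witness : ∀ {k} p F → EdgeSymmetric F → EdgeIrreflexive F → FinChromaticAtLeast F k →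
                   Avoids (Edge F) p → Σ OGraph λ G → IsSimple G × ChromaticAtLeast G k × Avoids (Adj G) p
finGraph-witness p F symmetric irreflexive χ≥k avoid =
  toOGraph F , simple , χ≥k′ ,
  avoids-pullback {E = Edge F} id (λ _ _ u<v → u<v) (λ u v → subst T (edgeℕ-toℕ F u v)) p avoid
  where
  simple : IsSimple (toOGraph F)
  simple = (λ u v → trans (edgeℕ-toℕ F u v) (trans (symmetric u v) (sym (edgeℕ-toℕ F v u))))
         , (λ u → trans (edgeℕ-toℕ F u u) (irreflexive u))
  χ≥k′ : ChromaticAtLeast (toOGraph F) _
  χ≥k′ m m<k (c , proper) =
    χ≥k m m<k (c , λ u v uv → proper u v (subst T (sym (edgeℕ-toℕ F u v)) uv))

⌊≟⌋-comm : ∀ {n} (i j : Fin n) → ⌊ i Fin.≟ j ⌋ ≡ ⌊ j Fin.≟ i ⌋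
⌊≟⌋-comm i j with i Fin.≟ j | j Fin.≟ i
... | yes _   | yes _   = refl
... | no _    | no _    = refl
... | yes i≡j | no j≢i  = ⊥-elim (j≢i (sym i≡j))
... | no i≢j  | yes j≡i = ⊥-elim (i≢j (sym j≡i))

-- The selectors w ∈ Fin (N ^ k), read as maps Fin k → Fin N, come first and form an
-- independent set; then follow k consecutive copies of F, and w is joined to the
-- vertex w i of the i-th copy.
module Zykov (k : ℕ) (F : FinGraph) where
  private
    N = order F
    P = N ^ k
    Q = k * N
  open Blocks {k} N

  Part : Set
  Part = Fin P ⊎ Fin Q

  selects : Fin P → Fin Q → Bool
  selects w r = ⌊ finToFun w (block r) Fin.≟ offset r ⌋

  part-edge : Part → Part → Bool
  part-edge (inj₁ _) (inj₁ _)  = false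
  part-edge (inj₁ w) (inj₂ r)  = selects w r
  part-edge (inj₂ r) (inj₁ w)  = selects w r
  part-edge (inj₂ r) (inj₂ r′) = ⌊ block r Fin.≟ block r′ ⌋ ∧ edge F (offset r) (offset r′)

  zykov : FinGraph
  zykov = finGraph (P + Q) λ x y → part-edge (splitAt P x) (splitAt P y)

  zykov-symmetric : EdgeSymmetric F → EdgeSymmetric zykov
  zykov-symmetric symmetric x y = part-symmetric (splitAt P x) (splitAt P y)
    where
    part-symmetric : ∀ s t → part-edge s t ≡ part-edge t s
    part-symmetric (inj₁ _) (inj₁ _)  = refl
    part-symmetric (inj₁ _) (inj₂ _)  = refl
    part-symmetric (inj₂ _) (inj₁ _)  = refl
    part-symmetric (inj₂ r) (inj₂ r′) =
      cong₂ _∧_ (⌊≟⌋-comm (block r) (block r′)) (symmetric (offset r) (offset r′))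

  zykov-irreflexive : EdgeIrreflexive F → EdgeIrreflexive zykov
  zykov-irreflexive irreflexive x = part-irreflexive (splitAt P x)
    where
    part-irreflexive : ∀ s → part-edge s s ≡ false
    part-irreflexive (inj₁ _) = refl
    part-irreflexive (inj₂ r) rewrite irreflexive (offset r) = ∧-zeroʳ _

  position : Part → ℕ
  position = toℕ ∘ join P Q

  toℕ-position : ∀ x → toℕ x ≡ position (splitAt P x)
  toℕ-position x = cong toℕ (sym (Fin.join-splitAt P Q x))

  selectors-first : ∀ r w → ¬ position (inj₂ r) < position (inj₁ w)
  selectors-first r w r<w = <⇒≱ r<w (begin
    toℕ (w ↑ˡ Q)  ≡⟨ Fin.toℕ-↑ˡ w Q ⟩
    toℕ w         ≤⟨ <⇒≤ (Fin.toℕ<n w) ⟩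
    P             ≤⟨ m≤m+n P (toℕ r) ⟩
    P + toℕ r     ≡⟨ Fin.toℕ-↑ʳ P r ⟨
    toℕ (P ↑ʳ r)  ∎)
    where open ≤-Reasoning

  copy-< : ∀ {r r′} → position (inj₂ r) < position (inj₂ r′) → toℕ r < toℕ r′
  copy-< {r} {r′} r<r′ = +-cancelˡ-< P _ _ (subst₂ _<_ (Fin.toℕ-↑ʳ P r) (Fin.toℕ-↑ʳ P r′) r<r′)

  copy-edge⁻ : ∀ {r r′} → T (part-edge (inj₂ r) (inj₂ r′)) →
               block r ≡ block r′ × Edge F (offset r) (offset r′)
  copy-edge⁻ t = Prod.map₁ toWitness (Equivalence.to T-∧ t)

  selected-blocks-< : ∀ {w r r′} → T (selects w r) → T (selects w r′) → toℕ r < toℕ r′ →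
                      toℕ (block r) < toℕ (block r′)
  selected-blocks-< {w} {r} {r′} wr wr′ r<r′ = ≤∧≢⇒< (block-mono r<r′) λ same-block →
    <-irrefl (cong toℕ (same-vertex (Fin.toℕ-injective same-block))) r<r′
    where
    same-vertex : block r ≡ block r′ → r ≡ r′
    same-vertex same = begin
      r                             ≡⟨ combine-block-offset r ⟨
      combine (block r) (offset r)  ≡⟨ cong₂ combine same (begin
        offset r                      ≡⟨ toWitness wr ⟨
        finToFun w (block r)          ≡⟨ cong (finToFun w) same ⟩
        finToFun w (block r′)         ≡⟨ toWitness wr′ ⟩
        offset r′                     ∎) ⟩
      combine (block r′) (offset r′) ≡⟨ combine-block-offset r′ ⟩
      r′                            ∎
      where open ≡-Reasoning

  part-avoids-crossing : Avoids (Edge F) crossing → ∀ a b c e →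
    position a < position b → position b < position c → position c < position e →
    T (part-edge a b) → T (part-edge a c) → T (part-edge b e) → ⊥
  part-avoids-crossing _ (inj₁ _) (inj₁ _) _ _ _ _ _ ()
  part-avoids-crossing _ (inj₁ _) (inj₂ _) (inj₁ _) _ _ _ _ _ ()
  part-avoids-crossing _ (inj₁ _) (inj₂ _) (inj₂ rc) (inj₁ we) _ _ c<e _ _ _ = selectors-first rc we c<e
  part-avoids-crossing _ (inj₁ w) (inj₂ rb) (inj₂ rc) (inj₂ re) _ b<c c<e wb wc be =
    <-asym (block-< (subst (λ z → toℕ z < toℕ (block rc)) (proj₁ (copy-edge⁻ be))
                           (selected-blocks-< wb wc (copy-< b<c))))
           (copy-< c<e)
  part-avoids-crossing _ (inj₂ ra) (inj₁ wb) _ _ a<b _ _ _ _ _ = selectors-first ra wb a<b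
  part-avoids-crossing _ (inj₂ _) (inj₂ rb) (inj₁ wc) _ _ b<c _ _ _ _ = selectors-first rb wc b<c
  part-avoids-crossing _ (inj₂ _) (inj₂ _) (inj₂ rc) (inj₁ we) _ _ c<e _ _ _ = selectors-first rc we c<e
  part-avoids-crossing avoid (inj₂ ra) (inj₂ rb) (inj₂ rc) (inj₂ re) a<b b<c c<e ab ac be =
    avoid (quadruple (offset ra) (offset rb) (offset rc) (offset re))
          (offset-< ab-block (copy-< a<b) , offset-< bc-block (copy-< b<c) , offset-< ce-block (copy-< c<e))
          (proj₂ (copy-edge⁻ ab) ∷ proj₂ (copy-edge⁻ ac) ∷ proj₂ (copy-edge⁻ be) ∷ [])
    where
    ab-block = proj₁ (copy-edge⁻ ab)
    bc-block = trans (sym ab-block) (proj₁ (copy-edge⁻ ac))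
    ce-block = trans (sym bc-block) (proj₁ (copy-edge⁻ be))

  zykov-avoids-crossing : Avoids (Edge F) crossing → Avoids (Edge zykov) crossing
  zykov-avoids-crossing avoid v (lt₀ , lt₁ , lt₂) (ab ∷ ac ∷ be ∷ []) =
    part-avoids-crossing avoid (splitAt P (v 0F)) (splitAt P (v 1F)) (splitAt P (v 2F)) (splitAt P (v 3F))
      (subst₂ _<_ (toℕ-position (v 0F)) (toℕ-position (v 1F)) lt₀)
      (subst₂ _<_ (toℕ-position (v 1F)) (toℕ-position (v 2F)) lt₁)
      (subst₂ _<_ (toℕ-position (v 2F)) (toℕ-position (v 3F)) lt₂)
      ab ac be

  copy : Fin k → Fin N → Fin (P + Q)
  copy i u = P ↑ʳ combine i u

  selector : (Fin k → Fin N) → Fin (P + Q)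
  selector t = funToFin t ↑ˡ Q

  copy-edge : ∀ i {u v} → Edge F u v → Edge zykov (copy i u) (copy i v)
  copy-edge i {u} {v} uv
    rewrite Fin.splitAt-↑ʳ P Q (combine i u) | Fin.splitAt-↑ʳ P Q (combine i v)
          | block-combine i u | block-combine i v | offset-combine i u | offset-combine i v
    = Equivalence.from T-∧ (fromWitness refl , uv)

  selector-edge : ∀ t i → Edge zykov (selector t) (copy i (t i))
  selector-edge t i
    rewrite Fin.splitAt-↑ˡ P (funToFin t) Q | Fin.splitAt-↑ʳ P Q (combine i (t i))
          | block-combine i (t i) | offset-combine i (t i)
    = fromWitness (Fin.finToFun-funToFin t i)

  -- Given a colouring with at most k colours, let the selector pick in each copy i a
  -- vertex of colour i whenever there is one; the colour j of that selector is then
  -- missing from the j-th copy, which is thus coloured with fewer than k colours.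
  zykov-chromatic : FinChromaticAtLeast F k → 0 < N → FinChromaticAtLeast zykov (suc k)
  zykov-chromatic _ 0<N zero _ (c , _) with c (selector λ _ → fromℕ< 0<N)
  ... | ()
  zykov-chromatic χ≥k 0<N (suc m) 1+m<1+k (c , proper) = [ same-colour , colour-missing ] (proj₂ (choice i))
    where
    choice : ∀ i → ∃ λ u → toℕ (c (copy i u)) ≡ toℕ i ⊎ (∀ u′ → toℕ (c (copy i u′)) ≢ toℕ i)
    choice i with Fin.any? (λ u → toℕ (c (copy i u)) ≟ toℕ i)
    ... | yes (u , colour-i) = u , inj₁ colour-i
    ... | no none = fromℕ< 0<N , inj₂ λ u colour-i → none (u , colour-i)
    t : Fin k → Fin N
    t i = proj₁ (choice i)
    j = c (selector t)
    j<k : toℕ j < k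
    j<k = <-≤-trans (Fin.toℕ<n j) (≤-pred 1+m<1+k)
    i = fromℕ< j<k
    toℕ-i : toℕ i ≡ toℕ j
    toℕ-i = Fin.toℕ-fromℕ< j<k
    same-colour : toℕ (c (copy i (t i))) ≡ toℕ i → ⊥
    same-colour colour-i = proper (selector t) (copy i (t i)) (selector-edge t i)
                                  (sym (Fin.toℕ-injective (trans colour-i toℕ-i)))
    colour-missing : (∀ u → toℕ (c (copy i u)) ≢ toℕ i) → ⊥
    colour-missing missing = χ≥k m (≤-pred 1+m<1+k) (c′ , proper′)
      where
      j≢ : ∀ u → j ≢ c (copy i u)
      j≢ u j≡ = missing u (trans (cong toℕ (sym j≡)) (sym toℕ-i))
      c′ : Fin N → Fin m
      c′ u = punchOut (j≢ u)
      proper′ : ∀ u v → Edge F u v → c′ u ≢ c′ v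
      proper′ u v uv = proper (copy i u) (copy i v) (copy-edge i uv) ∘ Fin.punchOut-injective (j≢ u) (j≢ v)

zykovFamily : ℕ → FinGraph
zykovFamily zero    = finGraph 1 λ _ _ → false
zykovFamily (suc k) = Zykov.zykov k (zykovFamily k)

zykovFamily-nonempty : ∀ k → 0 < order (zykovFamily k)
zykovFamily-nonempty zero = z<s
zykovFamily-nonempty (suc k) =
  ≤-trans (m^n>0 (order (zykovFamily k)) {{>-nonZero (zykovFamily-nonempty k)}} k) (m≤m+n _ _)

zykovFamily-symmetric : ∀ k → EdgeSymmetric (zykovFamily k)
zykovFamily-symmetric zero _ _ = refl
zykovFamily-symmetric (suc k) = Zykov.zykov-symmetric k _ (zykovFamily-symmetric k)

zykovFamily-irreflexive : ∀ k → EdgeIrreflexive (zykovFamily k)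
zykovFamily-irreflexive zero _ = refl
zykovFamily-irreflexive (suc k) = Zykov.zykov-irreflexive k _ (zykovFamily-irreflexive k)

zykovFamily-chromatic : ∀ k → FinChromaticAtLeast (zykovFamily k) k
zykovFamily-chromatic zero _ ()
zykovFamily-chromatic (suc k) = Zykov.zykov-chromatic k _ (zykovFamily-chromatic k) (zykovFamily-nonempty k)

zykovFamily-avoids-crossing : ∀ k → Avoids (Edge (zykovFamily k)) crossing
zykovFamily-avoids-crossing zero _ _ (() ∷ _)
zykovFamily-avoids-crossing (suc k) = Zykov.zykov-avoids-crossing k _ (zykovFamily-avoids-crossing k)

crossing-chiAvoidable : ChiAvoidable crossing
crossing-chiAvoidable k =
  finGraph-witness crossing (zykovFamily k) (zykovFamily-symmetric k) (zykovFamily-irreflexive k)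
                   (zykovFamily-chromatic k) (zykovFamily-avoids-crossing k)

indicator : {A : Set} → Dec A → Fin 2
indicator (yes _) = 1F
indicator (no _)  = 0F

indicator-yes : {A : Set} (a? : Dec A) → A → indicator a? ≡ 1F
indicator-yes (yes _) _ = refl
indicator-yes (no ¬a) a = ⊥-elim (¬a a)

indicator⁻ : {A : Set} (a? : Dec A) → indicator a? ≡ 1F → A
indicator⁻ (yes a) _ = a

-- Vertex combine i j stands for the pair (i , j); it is joined to (j , l) when
-- i < j < l.  The pairs with i ≥ j are isolated vertices.
module ShiftGraph (M : ℕ) where
  open Blocks {M} M

  links : Fin (M * M) → Fin (M * M) → Bool
  links x y = ⌊ (block x Fin.<? offset x) ×-dec (offset x Fin.≟ block y) ×-dec (block y Fin.<? offset y) ⌋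

  shiftGraph : FinGraph
  shiftGraph = finGraph (M * M) λ x y → links x y ∨ links y x

  links⁻ : ∀ {x y} → T (links x y) →
           toℕ (block x) < toℕ (offset x) × offset x ≡ block y × toℕ (block y) < toℕ (offset y)
  links⁻ = toWitness

  links-pair : ∀ {i j l} → toℕ i < toℕ j → toℕ j < toℕ l → T (links (combine i j) (combine j l))
  links-pair {i} {j} {l} i<j j<l
    rewrite block-combine i j | offset-combine i j | block-combine j l | offset-combine j l
    = fromWitness (i<j , refl , j<l)

  shiftGraph-symmetric : EdgeSymmetric shiftGraph
  shiftGraph-symmetric x y = ∨-comm (links x y) (links y x)

  links-irreflexive : ∀ x → ¬ T (links x x)
  links-irreflexive x t = let x< , x≡x , _ = links⁻ {x} t in <-irrefl (cong toℕ (sym x≡x)) x<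

  shiftGraph-irreflexive : EdgeIrreflexive shiftGraph
  shiftGraph-irreflexive x rewrite ¬T⇒≡false (links-irreflexive x) = refl

  links-oriented : ∀ {x y} → toℕ x < toℕ y → Edge shiftGraph x y → T (links x y)
  links-oriented {x} {y} x<y xy with Equivalence.to T-∨ xy
  ... | inj₁ x→y = x→y
  ... | inj₂ y→x = ⊥-elim (<-asym x<y (block-< block-y<block-x))
    where
    block-y<block-x : toℕ (block y) < toℕ (block x)
    block-y<block-x = let y< , y≡x , _ = links⁻ y→x in subst (λ b → toℕ (block y) < toℕ b) y≡x y<

  shiftGraph-avoids-nesting : Avoids (Edge shiftGraph) nesting
  shiftGraph-avoids-nesting v (a<b , b<c , c<e) (ab ∷ ae ∷ bc ∷ []) = <-asym c<e (block-< block-e<block-c)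
    where
    a→b = links⁻ (links-oriented a<b ab)
    a→e = links⁻ (links-oriented (<-trans a<b (<-trans b<c c<e)) ae)
    b→c = links⁻ (links-oriented b<c bc)
    block-e<block-c : toℕ (block (v 3F)) < toℕ (block (v 2F))
    block-e<block-c = subst₂ (λ p q → toℕ p < toℕ q)
      (trans (sym (proj₁ (proj₂ a→b))) (proj₁ (proj₂ a→e))) (proj₁ (proj₂ b→c)) (proj₁ b→c)

  -- The colours of the pairs ending at j form a subset of the K colours.  With more
  -- than 2 ^ K ends, two ends j₁ < j₂ have the same subset; the colour of (j₁ , j₂) then
  -- also occurs on some pair (i , j₁), which is adjacent to it.
  shiftGraph-chromatic : ∀ k → 2 ^ k < M → FinChromaticAtLeast shiftGraph k
  shiftGraph-chromatic k 2^k<M K K<k (c , proper) =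
    collision (Fin.pigeonhole (≤-<-trans (^-monoʳ-≤ 2 (<⇒≤ K<k)) 2^k<M) (funToFin ∘ colours-ending-at))
    where
    ends-at? : ∀ j colour → Dec (∃ λ (i : Fin M) → toℕ i < toℕ j × c (combine i j) ≡ colour)
    ends-at? j colour = Fin.any? λ i → (toℕ i <? toℕ j) ×-dec (c (combine i j) Fin.≟ colour)
    colours-ending-at : Fin M → Fin K → Fin 2
    colours-ending-at j colour = indicator (ends-at? j colour)
    collision : (∃ λ j₁ → ∃ λ j₂ → toℕ j₁ < toℕ j₂ ×
                   funToFin (colours-ending-at j₁) ≡ funToFin (colours-ending-at j₂)) → ⊥
    collision (j₁ , j₂ , j₁<j₂ , same) =
      proper (combine i j₁) (combine j₁ j₂) (Equivalence.from T-∨ (inj₁ (links-pair i<j₁ j₁<j₂))) colour-i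
      where
      colour = c (combine j₁ j₂)
      same-at : colours-ending-at j₁ colour ≡ colours-ending-at j₂ colour
      same-at = begin
        colours-ending-at j₁ colour                       ≡⟨ Fin.finToFun-funToFin (colours-ending-at j₁) colour ⟨
        finToFun (funToFin (colours-ending-at j₁)) colour ≡⟨ cong (λ z → finToFun z colour) same ⟩
        finToFun (funToFin (colours-ending-at j₂)) colour ≡⟨ Fin.finToFun-funToFin (colours-ending-at j₂) colour ⟩
        colours-ending-at j₂ colour                       ∎
        where open ≡-Reasoning
      witness = indicator⁻ (ends-at? j₁ colour)
                           (trans same-at (indicator-yes (ends-at? j₂ colour) (j₁ , j₁<j₂ , refl)))
      i = proj₁ witness
      i<j₁ = proj₁ (proj₂ witness)
      colour-i = proj₂ (proj₂ witness)

nesting-chiAvoidable : ChiAvoidable nesting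
nesting-chiAvoidable k =
  finGraph-witness nesting shiftGraph shiftGraph-symmetric shiftGraph-irreflexive
                   (shiftGraph-chromatic k ≤-refl) shiftGraph-avoids-nesting
  where open ShiftGraph (suc (2 ^ k))

rightCaterpillarShapeOf : ∀ G → IsSimple G → Connected G → HasEdge G → AtMostOneLeftNeighbour G →
                          Avoids (Adj G) crossing → Avoids (Adj G) nesting →
                          RightCaterpillarShape (size G) (adj G)
rightCaterpillarShapeOf G simple connected edge unique no-crossing no-nesting =
  rightCaterpillarShape (size G) (rightCaterpillarConditions G unique simple connected no-crossing no-nesting)
                        (hasEdge⇒1<size G simple edge)

lemma23 : (G : OGraph) → IsSimple G → ChiUnavoidable G → Connected G → HasEdge G →
              (AtMostOneLeftNeighbour G → IsRightCaterpillar G)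
              × (AtMostOneRightNeighbour G → IsLeftCaterpillar G)
lemma23 G simple unavoidable connected edge = right , left
  where
  avoids : ∀ p → ChiAvoidable p → Avoids (Adj G) p
  avoids p = chiUnavoidable-avoids {G} p unavoidable

  right : AtMostOneLeftNeighbour G → IsRightCaterpillar G
  right unique = shape⇒isRightCaterpillar G simple
    (rightCaterpillarShapeOf G simple connected edge unique
       (avoids crossing crossing-chiAvoidable) (avoids nesting nesting-chiAvoidable))

  mirror-avoids-mirrored : ∀ p → ChiAvoidable p → Avoids (Adj (mirror G)) (mirrorPattern (mirrorPattern p))
  mirror-avoids-mirrored p avoidable =
    mirror-avoids G (mirrorPattern p) (avoids (mirrorPattern p) (chiAvoidable-mirror p avoidable))

  -- mirrorPattern (mirrorPattern p) computes to p for the concrete patterns below.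
  left : AtMostOneRightNeighbour G → IsLeftCaterpillar G
  left unique = mirror-shape⇒isLeftCaterpillar G simple
    (rightCaterpillarShapeOf (mirror G) (mirror-simple G simple) (mirror-connected G connected)
       (mirror-hasEdge G edge) (mirror-atMostOneLeftNeighbour G simple unique)
       (mirror-avoids-mirrored crossing crossing-chiAvoidable)
       (mirror-avoids-mirrored nesting nesting-chiAvoidable))
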